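{- Let $(M,\nu,\mathfrak{e})$, $(\mathscr{O},\eta,e)$, $\tau$ form a $c$-monop and $V$ a finite set. On $(M\cdot E(\mathscr{O}))[V]$ define $(m_1,a_1)\leq(m_2,a_2)$ if there exists $(m_2',a_2')\in M[\pi_1]\times E(\mathscr{O})[\pi_2]$, for some splitting $\pi=\pi_1+\pi_2$ of the partition $\pi$ underlying $a_1$, such that $\bar\rho((m_1,a_1),(m_2',a_2'))=(m_2,a_2)$, i.e. $m_2=\nu(m_1,\tau(a_1^{(1)},m_2'))$ and $a_2=\bar\eta(a_1^{(2)},a_2')$. Then $\leq$ is a partial order.
   Context: Species are functors from finite sets with bijections to finite sets; positive means $F[\emptyset]=\emptyset$; sums are disjoint unions. Product $(M\cdot N)[V]=\sum_{V_1+V_2=V}M[V_1]\times N[V_2]$. For positive $P$, $R(P)[V]=\sum_\pi(\prod_{B\in\pi}P[B])\times R[\pi]$ over partitions $\pi$ of $V$; elements are pairs $(a,r)$ with $a=\{p_B\}_{B\in\pi}$ an assembly of $P$-structures. $E(P)[V]$ is the set of all assemblies of $P$-structures on $V$ (only the empty assembly if $V=\emptyset$). Thus elements of $(M\cdot E(\mathscr O))[V]$ are pairs $(m,a)$ with $m\in M[V_1]$, $a$ an assembly of $\mathscr O$-structures on $V_2$, $V=V_1+V_2$. Monoid $(M,\nu,\mathfrak e)$: $\nu:M\cdot M\to M$ associative with two-sided unit $\mathfrak e\in M[\emptyset]$. Operad $(\mathscr O,\eta,e)$: $\mathscr O$ positive, $\eta:\mathscr O(\mathscr O)\to\mathscr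 O$, $e_v\in\mathscr O[\{v\}]$; for an assembly $a=\{\omega_C\}_{C\in\pi}$ on $V$ and an assembly $b=\{w_D\}_{D\in\sigma}$ on the set $\pi$, $\bar\eta(a,b)=\{\eta(\{\omega_C\}_{C\in D},w_D)\}_{D\in\sigma}$; axioms $\eta(\bar\eta(a,b),\omega)=\eta(a,\eta(b,\omega))$, $\eta(\{e_v\}_{v\in V},\omega)=\omega=\eta(\{\omega\},e_V)$. Right module: $\tau:M(\mathscr O)\to M$ with $\tau(\bar\eta(a,b),m)=\tau(a,\tau(b,m))$ and $\tau(\{e_v\}_{v\in V},m)=m$. Compatibility: $\nu(\tau(a_1,m_1),\tau(a_2,m_2))=\tau(a_1\sqcup a_2,\nu(m_1,m_2))$ for disjoint supports. A $c$-monop is such data ($M$ a monoid and right $\mathscr O$-module with $\nu,\tau$ compatible) with in addition: $|M[\emptyset]|=1$; $\nu(m_1,m_2)=\nu(m_1,m_2')\Rightarrow m_2=m_2'$; $|\mathscr O[\{v\}]|=1$ for every singleton; $\eta(a,\omega)=\eta(a,\omega')\Rightarrow\omega=\omega'$; $\tau(a,m)=\tau(a,m')\Rightarrow m=m'$. Here $a_1^{(i)}$ denotes the subassembly of $a_1$ with underlying partition $\pi_i$, and $\bar\rho((m_1,a_1),(m_2',a_2')):=(\nu(m_1,\tau(a_1^{(1)},m_2')),\bar\eta(a_1^{(2)},a_2'))$. -}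

module Defs where

open import Data.Nat.Base using (ℕ; zero; suc; _≡ᵇ_; _^_; _%_; ⌊_/2⌋)
open import Data.Bool.Base using (Bool; true; false; T; not; _∧_; _∨_)
open import Data.List.Base using (List; []; _∷_; filterᵇ; upTo)
open import Data.Bool.ListAction using (all; any)
open import Data.List.Membership.Propositional using (_∈_)
open import Data.List.Relation.Unary.All using (All; lookup)
open import Data.Product.Base using (Σ; _×_; _,_; proj₁)
open import Data.Empty using (⊥)
open import Function.Bundles using (_↔_; Inverse)
open import Relation.Binary.PropositionalEquality using (_≡_; subst; sym)

-- We use hereditarily finite sets in the Ackermann coding:
-- the natural number s codes the finite set { i | bit i of s is 1 }.
-- Every finite set of labels, every set of blocks, every set of sets of
-- blocks etc. is thus a natural number, and equality of finite sets is
-- propositional equality of codes (the coding is a bijection).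

bit : ℕ → ℕ → Bool
bit n zero    = (n % 2) ≡ᵇ 1
bit n (suc i) = bit ⌊ n /2⌋ i

_∈ₕ_ : ℕ → ℕ → Set
i ∈ₕ s = T (bit s i)

-- the elements of s, in increasing order (every element of s is < s)
elems : ℕ → List ℕ
elems s = filterᵇ (bit s) (upTo s)

Elem : ℕ → Set
Elem s = Σ ℕ (λ i → i ∈ₕ s)

val : ∀ {s} → Elem s → ℕ
val = proj₁

｛_｝ : ℕ → ℕ
｛ v ｝ = 2 ^ v

subsetᵇ : ℕ → ℕ → Bool
subsetᵇ s t = all (bit t) (elems s)

disjointᵇ : ℕ → ℕ → Bool
disjointᵇ s t = all (λ i → not (bit t i)) (elems s)

decompᵇ : ℕ → ℕ → ℕ → Bool
decompᵇ V V₁ V₂ =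
  subsetᵇ V₁ V ∧ subsetᵇ V₂ V ∧ disjointᵇ V₁ V₂
  ∧ all (λ i → bit V₁ i ∨ bit V₂ i) (elems V)

isPartᵇ : ℕ → ℕ → Bool
isPartᵇ V p =
  all (λ B → not (B ≡ᵇ 0) ∧ subsetᵇ B V) (elems p)
  ∧ all (λ B → all (λ B' → (B ≡ᵇ B') ∨ disjointᵇ B B') (elems p)) (elems p)
  ∧ all (λ i → any (λ B → bit B i) (elems p)) (elems V)

IsBigUnion : ℕ → ℕ → Set
IsBigUnion U D = ∀ i →
  (i ∈ₕ U → Σ ℕ (λ C → C ∈ₕ D × i ∈ₕ C)) ×
  (Σ ℕ (λ C → C ∈ₕ D × i ∈ₕ C) → i ∈ₕ U)

-- h : A ≅ B is the restriction of f : V ≅ W (on underlying labels)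
Agrees : ∀ {A B V W} → Elem A ↔ Elem B → Elem V ↔ Elem W → Set
Agrees h f = ∀ x y → val x ≡ val y → val (Inverse.to h x) ≡ val (Inverse.to f y)

IsImage : ∀ {V W} → Elem V ↔ Elem W → ℕ → ℕ → Set
IsImage f B B' = ∀ i →
  (i ∈ₕ B' → Σ (Elem _) (λ y → val y ∈ₕ B × val (Inverse.to f y) ≡ i)) ×
  (Σ (Elem _) (λ y → val y ∈ₕ B × val (Inverse.to f y) ≡ i) → i ∈ₕ B')

record Species : Set₁ where
  field
    F     : ℕ → Set
    tr    : ∀ {s t} → Elem s ↔ Elem t → F s → F t
    tr-id : ∀ {s} (φ : Elem s ↔ Elem s) →
            (∀ x → val (Inverse.to φ x) ≡ val x) → ∀ y → tr φ y ≡ y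
    tr-∘  : ∀ {s t u} (φ : Elem s ↔ Elem t) (ψ : Elem t ↔ Elem u)
            (χ : Elem s ↔ Elem u) →
            (∀ x → val (Inverse.to χ x) ≡ val (Inverse.to ψ (Inverse.to φ x))) →
            ∀ y → tr χ y ≡ tr ψ (tr φ y)
open Species public

record Prod (A B : ℕ → Set) (V : ℕ) : Set where
  constructor prod
  field
    V₁  : ℕ
    V₂  : ℕ
    dec : T (decompᵇ V V₁ V₂)
    fst : A V₁
    snd : B V₂
open Prod public

-- E(P)[V]: an assembly of P-structures on V: a partition together with
-- a P-structure on each block (listed in increasing order of block codes)
record Asm (P : ℕ → Set) (V : ℕ) : Set where
  constructor asm
  field
    part   : ℕ
    isPart : T (isPartᵇ V part)
    comps  : All P (elems part)
open Asm public

blocks : ∀ {P V} → Asm P V → List ℕ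
blocks a = elems (part a)

-- r is a subassembly of a (its blocks are blocks of a, with the same
-- structures); its ground set is then the union of its blocks
IsSubAsm : ∀ {P V U} → Asm P V → Asm P U → Set
IsSubAsm a r =
  (∀ C → C ∈ₕ part r → C ∈ₕ part a) ×
  (∀ C (x : C ∈ blocks r) (y : C ∈ blocks a) →
     lookup (comps r) x ≡ lookup (comps a) y)

-- c = η̄(a, b): the graph of η̄
IsEtaBar : (P : ℕ → Set) (η : ∀ {U} (r : Asm P U) → P (part r) → P U) →
           ∀ {V} (a : Asm P V) → Asm P (part a) → Asm P V → Set
IsEtaBar P η a b c =
  (∀ U → (U ∈ₕ part c → Σ ℕ (λ D → D ∈ₕ part b × IsBigUnion U D)) ×
         (Σ ℕ (λ D → D ∈ₕ part b × IsBigUnion U D) → U ∈ₕ part c)) ×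
  (∀ D U (x : D ∈ blocks b) (y : U ∈ blocks c) → IsBigUnion U D →
     ∀ (r : Asm P U) (e : part r ≡ D) → IsSubAsm a r →
     lookup (comps c) y ≡ η r (subst P (sym e) (lookup (comps b) x)))

InducedBlocks : ∀ {V W p p'} → Elem V ↔ Elem W → Elem p ↔ Elem p' → Set
InducedBlocks f g = ∀ B → IsImage f (val B) (val (Inverse.to g B))

TransportedComps : (P : Species) → ∀ {V W} → Elem V ↔ Elem W →
  (a : Asm (F P) V) (a' : Asm (F P) W) → Elem (part a) ↔ Elem (part a') → Set
TransportedComps P f a a' g =
  ∀ B B' (x : B ∈ blocks a) (y : B' ∈ blocks a') (bB : B ∈ₕ part a) →
  val (Inverse.to g (B , bB)) ≡ B' →
  (h : Elem B ↔ Elem B') → Agrees h f →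
  lookup (comps a') y ≡ tr P h (lookup (comps a) x)

record CMonop : Set₁ where
  field
    M O : Species
    ν : ∀ {V} → Prod (F M) (F M) V → F M V
    𝔢 : F M 0
    ν-natural : ∀ {V W V₁ V₂ W₁ W₂} (f : Elem V ↔ Elem W)
      (p : T (decompᵇ V V₁ V₂)) (q : T (decompᵇ W W₁ W₂))
      (f₁ : Elem V₁ ↔ Elem W₁) (f₂ : Elem V₂ ↔ Elem W₂) →
      Agrees f₁ f → Agrees f₂ f → ∀ m₁ m₂ →
      ν (prod W₁ W₂ q (tr M f₁ m₁) (tr M f₂ m₂)) ≡ tr M f (ν (prod V₁ V₂ p m₁ m₂))
    ν-assoc : ∀ {V V₁ V₂ V₃ V₁₂ V₂₃}
      (p : T (decompᵇ V V₁₂ V₃)) (q : T (decompᵇ V₁₂ V₁ V₂))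
      (r : T (decompᵇ V V₁ V₂₃)) (s : T (decompᵇ V₂₃ V₂ V₃)) m₁ m₂ m₃ →
      ν (prod V₁₂ V₃ p (ν (prod V₁ V₂ q m₁ m₂)) m₃)
        ≡ ν (prod V₁ V₂₃ r m₁ (ν (prod V₂ V₃ s m₂ m₃)))
    ν-unitˡ : ∀ {V} (p : T (decompᵇ V 0 V)) m → ν (prod 0 V p 𝔢 m) ≡ m
    ν-unitʳ : ∀ {V} (p : T (decompᵇ V V 0)) m → ν (prod V 0 p m 𝔢) ≡ m
    O-positive : F O 0 → ⊥
    η : ∀ {V} (a : Asm (F O) V) → F O (part a) → F O V
    e : ∀ v → F O ｛ v ｝
    η-natural : ∀ {V W} (f : Elem V ↔ Elem W) (a : Asm (F O) V)
      (a' : Asm (F O) W) (g : Elem (part a) ↔ Elem (part a')) →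
      InducedBlocks f g → TransportedComps O f a a' g →
      ∀ ω → η a' (tr O g ω) ≡ tr O f (η a ω)
    e-natural : ∀ v w (h : Elem ｛ v ｝ ↔ Elem ｛ w ｝) → tr O h (e v) ≡ e w
    η-assoc : ∀ {V} (a : Asm (F O) V) (b : Asm (F O) (part a)) (c : Asm (F O) V) →
      IsEtaBar (F O) η a b c →
      (φ : Elem (part b) ↔ Elem (part c)) →
      (∀ D → IsBigUnion (val (Inverse.to φ D)) (val D)) →
      ∀ ω → η c (tr O φ ω) ≡ η a (η b ω)
    η-unitˡ : ∀ {V} (a : Asm (F O) V) (φ : Elem V ↔ Elem (part a)) →
      (∀ x → val (Inverse.to φ x) ≡ ｛ val x ｝) →
      (∀ v (x : ｛ v ｝ ∈ blocks a) → lookup (comps a) x ≡ e v) →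
      ∀ ω → η a (tr O φ ω) ≡ ω
    η-unitʳ : ∀ {V} (ω : F O V) (a : Asm (F O) V) (eq : part a ≡ ｛ V ｝) →
      (∀ (x : V ∈ blocks a) → lookup (comps a) x ≡ ω) →
      η a (subst (F O) (sym eq) (e V)) ≡ ω
    τ : ∀ {V} (a : Asm (F O) V) → F M (part a) → F M V
    τ-natural : ∀ {V W} (f : Elem V ↔ Elem W) (a : Asm (F O) V)
      (a' : Asm (F O) W) (g : Elem (part a) ↔ Elem (part a')) →
      InducedBlocks f g → TransportedComps O f a a' g →
      ∀ m → τ a' (tr M g m) ≡ tr M f (τ a m)
    τ-assoc : ∀ {V} (a : Asm (F O) V) (b : Asm (F O) (part a)) (c : Asm (F O) V) →
      IsEtaBar (F O) η a b c →
      (φ : Elem (part b) ↔ Elem (part c)) →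
      (∀ D → IsBigUnion (val (Inverse.to φ D)) (val D)) →
      ∀ m → τ c (tr M φ m) ≡ τ a (τ b m)
    τ-unit : ∀ {V} (a : Asm (F O) V) (φ : Elem V ↔ Elem (part a)) →
      (∀ x → val (Inverse.to φ x) ≡ ｛ val x ｝) →
      (∀ v (x : ｛ v ｝ ∈ blocks a) → lookup (comps a) x ≡ e v) →
      ∀ m → τ a (tr M φ m) ≡ m
    compat : ∀ {V V₁ V₂} (p : T (decompᵇ V V₁ V₂))
      (a₁ : Asm (F O) V₁) (a₂ : Asm (F O) V₂) (a : Asm (F O) V)
      (q : T (decompᵇ (part a) (part a₁) (part a₂))) →
      IsSubAsm a a₁ → IsSubAsm a a₂ → ∀ m₁ m₂ →
      ν (prod V₁ V₂ p (τ a₁ m₁) (τ a₂ m₂)) ≡ τ a (ν (prod (part a₁) (part a₂) q m₁ m₂))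
    M∅-single : ∀ (x : F M 0) → x ≡ 𝔢
    ν-cancel : ∀ {V V₁ V₂} (p : T (decompᵇ V V₁ V₂)) m₁ m₂ m₂' →
      ν (prod V₁ V₂ p m₁ m₂) ≡ ν (prod V₁ V₂ p m₁ m₂') → m₂ ≡ m₂'
    O-single : ∀ v (x : F O ｛ v ｝) → x ≡ e v
    η-cancel : ∀ {V} (a : Asm (F O) V) ω ω' → η a ω ≡ η a ω' → ω ≡ ω'
    τ-cancel : ∀ {V} (a : Asm (F O) V) m m' → τ a m ≡ τ a m' → m ≡ m'

MEO : CMonop → ℕ → Set
MEO C V = Prod (F (CMonop.M C)) (Asm (F (CMonop.O C))) V

-- (m₁, a₁) ≤ (m₂, a₂): there are a splitting π = π₁ + π₂ of the partition
-- of a₁ (π₁, π₂ being the partitions of the subassemblies a₁⁽¹⁾, a₁⁽²⁾),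
-- m₂' ∈ M[π₁] and a₂' ∈ E(O)[π₂] with
--   m₂ = ν(m₁, τ(a₁⁽¹⁾, m₂'))  and  a₂ = η̄(a₁⁽²⁾, a₂').
Leq : (C : CMonop) → ∀ {V} → MEO C V → MEO C V → Set
Leq C x y =
  Σ ℕ λ U₁ →
  Σ (Asm (F O) U₁) λ s₁ →
  Σ (Asm (F O) (V₂ y)) λ s₂ →
  IsSubAsm (snd x) s₁ × IsSubAsm (snd x) s₂ ×
  T (decompᵇ (part (snd x)) (part s₁) (part s₂)) ×
  (Σ (F M (part s₁)) λ m₂' →
   Σ (Asm (F O) (part s₂)) λ a₂' →
   Σ (T (decompᵇ (V₁ y) (V₁ x) U₁)) λ r →
     (fst y ≡ ν (prod (V₁ x) U₁ r (fst x) (τ s₁ m₂'))) ×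
     IsEtaBar (F O) η s₂ a₂' (snd y))
  where open CMonop C

-- Reflexivity: absorb nothing into M (empty a⁽¹⁾, m₂' = 𝔢) and compose a with the assembly
-- of units, since η̄(a, units) = a by the right unit law.
--
-- Antisymmetry: x ≤ y forces V₁(x) ⊆ V₁(y), so x ≤ y ≤ x gives V₁(x) = V₁(y). Then no block
-- is absorbed into M, so m is unchanged, and a₂ = η̄(a₁, a₂') with each partition refining the
-- other; hence every block of a₂' is a singleton, over which η is the identity.
--
-- Transitivity: let x ≤ y via (a⁽¹⁾, a⁽²⁾, m', a') and y ≤ z via (t₁, t₂, n', b'). Sorting the
-- blocks D of a' by whether ⋃ D is a block of t₁ or of t₂ splits a⁽²⁾ into the blocks lying over
-- t₁ and those over t₂. The former join a⁽¹⁾ in the part absorbed into M, where τ-associativity,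
-- associativity of ν and its compatibility with τ rewrite m_z; over t₂ the two η̄-steps compose
-- to a single one by associativity of η.

module Submission where

open import Defs
open import Data.Bool.Base using (Bool; true; false; T; not; _∧_; _∨_)
open import Data.Bool.Properties using (T-∧; T-∨; T-not-≡; T-irrelevant; T?)
open import Data.Bool.ListAction using (all; any)
open import Data.Empty using (⊥; ⊥-elim)
open import Data.List.Base using (List; []; _∷_; foldr; map; upTo)
open import Data.List.Membership.Propositional using (_∈_; find; lose)
open import Data.List.Membership.Propositional.Properties
  using (∈-filter⁺; ∈-filter⁻; ∈-upTo⁺; ∈-map⁺; ∈-map⁻)
import Data.List.Membership.Setoid.Properties as SetoidMembership
open import Data.List.Relation.Unary.All using (All; []; _∷_; lookup; tabulate)
import Data.List.Relation.Unary.All.Properties as All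
import Data.List.Relation.Unary.Any.Properties as Any
open import Data.List.Relation.Unary.Any using (here; there)
import Data.List.Relation.Unary.Unique.Propositional.Properties as Unique
open import Data.Nat.Base
open import Data.Nat.Properties
  using (<⇒≤; +-suc; ≡ᵇ⇒≡; ≡⇒≡ᵇ; <ᵇ⇒<; <⇒<ᵇ; ≤-trans; m<n⇒m<1+n; m≤m+n; m≤n+m
        ; ≡-irrelevant; _≟_)
open import Data.Product using (Σ; ∃-syntax; _×_; _,_; proj₁; proj₂)
open import Data.Sum as Sum using (_⊎_; inj₁; inj₂; [_,_])
open import Function using (_∘_; id; case_of_)
open import Function.Bundles using (_⇔_; mk⇔; Equivalence; _↔_; Inverse; mk↔ₛ′)
open import Function.Properties.Inverse using (↔-refl; ↔-sym)
open import Relation.Binary.PropositionalEquality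
  using (_≡_; _≢_; refl; sym; trans; cong; cong₂; subst; setoid; isEquivalence; module ≡-Reasoning)
open import Relation.Binary.Structures using (IsPartialOrder)
open import Relation.Nullary using (yes; no; ¬_)

open Equivalence using (to; from)

-- Binary expansions

dbl : ℕ → ℕ
dbl zero    = zero
dbl (suc n) = suc (suc (dbl n))

bitCons : Bool → ℕ → ℕ
bitCons false n = dbl n
bitCons true  n = suc (dbl n)

bit-bitCons-zero : ∀ b n → bit (bitCons b n) 0 ≡ b
bit-bitCons-zero false zero    = refl
bit-bitCons-zero false (suc n) = bit-bitCons-zero false n
bit-bitCons-zero true  zero    = refl
bit-bitCons-zero true  (suc n) = bit-bitCons-zero true n

⌊bitCons/2⌋ : ∀ b n → ⌊ bitCons b n /2⌋ ≡ n
⌊bitCons/2⌋ false zero    = refl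
⌊bitCons/2⌋ false (suc n) = cong suc (⌊bitCons/2⌋ false n)
⌊bitCons/2⌋ true  zero    = refl
⌊bitCons/2⌋ true  (suc n) = cong suc (⌊bitCons/2⌋ true n)

bit-bitCons-suc : ∀ b n i → bit (bitCons b n) (suc i) ≡ bit n i
bit-bitCons-suc b n i = cong (λ m → bit m i) (⌊bitCons/2⌋ b n)

bit-zero : ∀ i → bit 0 i ≡ false
bit-zero zero    = refl
bit-zero (suc i) = bit-zero i

data Binary : ℕ → Set where
  zero : Binary 0
  cons : ∀ b {n} → Binary n → Binary (bitCons b n)

binary-suc : ∀ {n} → Binary n → Binary (suc n)
binary-suc zero           = cons true zero
binary-suc (cons false x) = cons true x
binary-suc (cons true x)  = cons false (binary-suc x)

binary : ∀ n → Binary n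
binary zero    = zero
binary (suc n) = binary-suc (binary n)

bits-injective : ∀ {s t} → Binary s → Binary t → (∀ i → bit s i ≡ bit t i) → s ≡ t
bits-injective zero zero _ = refl
-- In the next two clauses 0 is bitCons false 0 definitionally.
bits-injective zero (cons b {n} y) h =
  cong₂ bitCons (trans (h 0) (bit-bitCons-zero b n))
                (bits-injective zero y λ i → trans (h (suc i)) (bit-bitCons-suc b n i))
bits-injective (cons b {n} x) zero h =
  cong₂ bitCons (trans (sym (bit-bitCons-zero b n)) (h 0))
                (bits-injective x zero λ i → trans (sym (bit-bitCons-suc b n i)) (h (suc i)))
bits-injective (cons b {m} x) (cons c {n} y) h =
  cong₂ bitCons (trans (sym (bit-bitCons-zero b m)) (trans (h 0) (bit-bitCons-zero c n)))
                (bits-injective x y λ i →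
                  trans (sym (bit-bitCons-suc b m i)) (trans (h (suc i)) (bit-bitCons-suc c n i)))

<-dbl : ∀ {i n} → i < n → suc i < dbl n
<-dbl {zero}  {suc n} _         = s≤s (s≤s z≤n)
<-dbl {suc i} {suc n} (s≤s i<n) = s≤s (s≤s (<⇒≤ (<-dbl i<n)))

set-bit⇒< : ∀ {s} → Binary s → ∀ i → T (bit s i) → i < s
set-bit⇒< zero i h = ⊥-elim (subst T (bit-zero i) h)
set-bit⇒< (cons false {n} x) zero h = ⊥-elim (subst T (bit-bitCons-zero false n) h)
set-bit⇒< (cons true x) zero h = s≤s z≤n
set-bit⇒< (cons false {n} x) (suc i) h =
  <-dbl (set-bit⇒< x i (subst T (bit-bitCons-suc false n i) h))
set-bit⇒< (cons true {n} x) (suc i) h =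
  m<n⇒m<1+n (<-dbl (set-bit⇒< x i (subst T (bit-bitCons-suc true n i) h)))

-- Finite sets

infix 4 _⊆ₕ_

_⊆ₕ_ : ℕ → ℕ → Set
s ⊆ₕ t = ∀ i → i ∈ₕ s → i ∈ₕ t

Disjoint : ℕ → ℕ → Set
Disjoint s t = ∀ i → i ∈ₕ s → i ∈ₕ t → ⊥

∈⇒< : ∀ {s i} → i ∈ₕ s → i < s
∈⇒< {s} {i} = set-bit⇒< (binary s) i

∉0 : ∀ i → ¬ i ∈ₕ 0
∉0 i = subst T (bit-zero i)

T-injective : ∀ {a b} → (T a → T b) → (T b → T a) → a ≡ b
T-injective {false} {false} _ _ = refl
T-injective {false} {true}  _ g = ⊥-elim (g _)
T-injective {true}  {false} f _ = ⊥-elim (f _)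
T-injective {true}  {true}  _ _ = refl

set-ext : ∀ {s t} → s ⊆ₕ t → t ⊆ₕ s → s ≡ t
set-ext {s} {t} s⊆t t⊆s =
  bits-injective (binary s) (binary t) λ i → T-injective (s⊆t i) (t⊆s i)

uninhabited⇒≡0 : ∀ {s} → (∀ i → ¬ i ∈ₕ s) → s ≡ 0
uninhabited⇒≡0 empty = set-ext (λ i i∈s → ⊥-elim (empty i i∈s)) (λ i i∈0 → ⊥-elim (∉0 i i∈0))

∈-elems : ∀ {s i} → i ∈ elems s ⇔ i ∈ₕ s
∈-elems {s} = mk⇔ (proj₂ ∘ ∈-filter⁻ (T? ∘ bit s) {xs = upTo s})
                  (λ i∈s → ∈-filter⁺ (T? ∘ bit s) (∈-upTo⁺ (∈⇒< i∈s)) i∈s)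

∈-elems-irrelevant : ∀ {s i} (x y : i ∈ elems s) → x ≡ y
∈-elems-irrelevant {s} = SetoidMembership.unique⇒irrelevant (setoid ℕ) ≡-irrelevant
  (Unique.filter⁺ (T? ∘ bit s) (Unique.upTo⁺ s))

T-all-elems : ∀ {p s} → T (all p (elems s)) ⇔ (∀ i → i ∈ₕ s → T (p i))
T-all-elems {p} {s} = mk⇔
  (λ h i i∈s → lookup (All.all⁺ p _ h) (from (∈-elems {s}) i∈s))
  (λ h → All.all⁻ p (tabulate λ {i} i∈ → h i (to (∈-elems {s}) i∈)))

T-any-elems : ∀ {p s} → T (any p (elems s)) ⇔ (∃[ i ] (i ∈ₕ s × T (p i)))
T-any-elems {p} {s} = mk⇔
  (λ h → let i , i∈ , pi = find (Any.any⁻ p _ h) in i , to (∈-elems {s}) i∈ , pi)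
  (λ (i , i∈s , pi) → Any.any⁺ p (lose (from (∈-elems {s}) i∈s) pi))

T-subsetᵇ : ∀ {s t} → T (subsetᵇ s t) ⇔ s ⊆ₕ t
T-subsetᵇ = T-all-elems

T-disjointᵇ : ∀ {s t} → T (disjointᵇ s t) ⇔ Disjoint s t
T-disjointᵇ {s} {t} = mk⇔
  (λ h i i∈s i∈t → subst T (to T-not-≡ (to T-all-elems h i i∈s)) i∈t)
  (λ h → from T-all-elems λ i i∈s → from T-not-≡ (T-injective (h i i∈s) λ ()))

setOf : (ℕ → Bool) → ℕ → ℕ
setOf p zero    = 0
setOf p (suc n) = bitCons (p 0) (setOf (p ∘ suc) n)

bit-setOf : ∀ p n i → bit (setOf p n) i ≡ (i <ᵇ n) ∧ p i
bit-setOf p zero    i       = bit-zero i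
bit-setOf p (suc n) zero    = bit-bitCons-zero (p 0) (setOf (p ∘ suc) n)
bit-setOf p (suc n) (suc i) =
  trans (bit-bitCons-suc (p 0) (setOf (p ∘ suc) n) i) (bit-setOf (p ∘ suc) n i)

∈-setOf : ∀ p n i → i ∈ₕ setOf p n ⇔ (i < n × T (p i))
∈-setOf p n i = mk⇔
  (λ h → let i<n , pi = to T-∧ (subst T (bit-setOf p n i) h) in <ᵇ⇒< i n i<n , pi)
  (λ (i<n , pi) → subst T (sym (bit-setOf p n i)) (from T-∧ (<⇒<ᵇ i<n , pi)))

infixl 21 _∪_

_∪_ : ℕ → ℕ → ℕ
s ∪ t = setOf (λ i → bit s i ∨ bit t i) (s + t)

∈-∪ : ∀ s t i → i ∈ₕ s ∪ t ⇔ (i ∈ₕ s ⊎ i ∈ₕ t)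
∈-∪ s t i = mk⇔ (to (T-∨ {bit s i}) ∘ proj₂ ∘ to ∈s∪t) (from ∈s∪t ∘ [ inˡ , inʳ ])
  where
  ∈s∪t = ∈-setOf (λ i → bit s i ∨ bit t i) (s + t) i
  inˡ : i ∈ₕ s → i < s + t × T (bit s i ∨ bit t i)
  inˡ i∈s = ≤-trans (∈⇒< i∈s) (m≤m+n s t) , from T-∨ (inj₁ i∈s)
  inʳ : i ∈ₕ t → i < s + t × T (bit s i ∨ bit t i)
  inʳ i∈t = ≤-trans (∈⇒< i∈t) (m≤n+m t s) , from (T-∨ {bit s i}) (inj₂ i∈t)

filterₕ : (ℕ → Bool) → ℕ → ℕ
filterₕ p s = setOf (λ i → bit s i ∧ p i) s

∈-filterₕ : ∀ p s i → i ∈ₕ filterₕ p s ⇔ (i ∈ₕ s × T (p i))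
∈-filterₕ p s i = mk⇔ (to (T-∧ {bit s i}) ∘ proj₂ ∘ to ∈filter)
                      (λ (i∈s , pi) → from ∈filter (∈⇒< i∈s , from T-∧ (i∈s , pi)))
  where ∈filter = ∈-setOf (λ i → bit s i ∧ p i) s i

⋃ᴸ : List ℕ → ℕ
⋃ᴸ = foldr _∪_ 0

∈-⋃ᴸ : ∀ i Cs → i ∈ₕ ⋃ᴸ Cs ⇔ (∃[ C ] (C ∈ Cs × i ∈ₕ C))
∈-⋃ᴸ i [] = mk⇔ (λ i∈0 → ⊥-elim (∉0 i i∈0)) λ ()
∈-⋃ᴸ i (C ∷ Cs) = mk⇔
  (λ i∈ → case-∪ (to (∈-∪ C (⋃ᴸ Cs) i) i∈))
  λ where (_ , here refl , i∈C) → from (∈-∪ C (⋃ᴸ Cs) i) (inj₁ i∈C)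
          (D , there D∈ , i∈D) → from (∈-∪ C (⋃ᴸ Cs) i) (inj₂ (from (∈-⋃ᴸ i Cs) (D , D∈ , i∈D)))
  where
  case-∪ : i ∈ₕ C ⊎ i ∈ₕ ⋃ᴸ Cs → ∃[ D ] (D ∈ C ∷ Cs × i ∈ₕ D)
  case-∪ (inj₁ i∈C)  = C , here refl , i∈C
  case-∪ (inj₂ i∈Cs) = let D , D∈ , i∈D = to (∈-⋃ᴸ i Cs) i∈Cs in D , there D∈ , i∈D

⋃ : ℕ → ℕ
⋃ D = ⋃ᴸ (elems D)

∈-⋃ : ∀ D i → i ∈ₕ ⋃ D ⇔ (∃[ C ] (C ∈ₕ D × i ∈ₕ C))
∈-⋃ D i = mk⇔
  (λ i∈ → let C , C∈ , i∈C = to (∈-⋃ᴸ i (elems D)) i∈ in C , to ∈-elems C∈ , i∈C)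
  (λ (C , C∈D , i∈C) → from (∈-⋃ᴸ i (elems D)) (C , from ∈-elems C∈D , i∈C))

⋃-isBigUnion : ∀ D → IsBigUnion (⋃ D) D
⋃-isBigUnion D i = to (∈-⋃ D i) , from (∈-⋃ D i)

isBigUnion⇒≡⋃ : ∀ {U D} → IsBigUnion U D → U ≡ ⋃ D
isBigUnion⇒≡⋃ {U} {D} U=⋃D =
  set-ext (λ i → from (∈-⋃ D i) ∘ proj₁ (U=⋃D i))
          (λ i → proj₂ (U=⋃D i) ∘ to (∈-⋃ D i))

｛｝-bitCons : ∀ v → ｛ suc v ｝ ≡ bitCons false ｛ v ｝
｛｝-bitCons v = dbl-+ (2 ^ v)
  where
  dbl-+ : ∀ n → n + (n + 0) ≡ dbl n
  dbl-+ zero    = refl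
  dbl-+ (suc n) = cong suc (trans (+-suc n (n + 0)) (cong suc (dbl-+ n)))

bit-｛｝ : ∀ v i → bit ｛ v ｝ i ≡ (i ≡ᵇ v)
bit-｛｝ zero    zero    = refl
bit-｛｝ zero    (suc i) = bit-zero i
bit-｛｝ (suc v) i rewrite ｛｝-bitCons v with i
... | zero  = bit-bitCons-zero false ｛ v ｝
... | suc i = trans (bit-bitCons-suc false ｛ v ｝ i) (bit-｛｝ v i)

∈-｛｝ : ∀ v i → i ∈ₕ ｛ v ｝ ⇔ i ≡ v
∈-｛｝ v i = mk⇔ (≡ᵇ⇒≡ i v ∘ subst T (bit-｛｝ v i))
                 (subst T (sym (bit-｛｝ v i)) ∘ ≡⇒≡ᵇ i v)

｛｝-isBigUnion : ∀ U → IsBigUnion U ｛ U ｝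
｛｝-isBigUnion U i =
  (λ i∈U → U , from (∈-｛｝ U U) refl , i∈U) ,
  (λ (C , C∈ , i∈C) → subst (i ∈ₕ_) (to (∈-｛｝ U C) C∈) i∈C)

⋃-∪ : ∀ p q → ⋃ (p ∪ q) ≡ ⋃ p ∪ ⋃ q
⋃-∪ p q = set-ext
  (λ i i∈ → let C , C∈ , i∈C = to (∈-⋃ (p ∪ q) i) i∈
            in from (∈-∪ (⋃ p) (⋃ q) i) (Sum.map (λ C∈p → from (∈-⋃ p i) (C , C∈p , i∈C))
                                                      (λ C∈q → from (∈-⋃ q i) (C , C∈q , i∈C))
                                                      (to (∈-∪ p q C) C∈)))
  (λ i → [ (λ i∈ → let C , C∈p , i∈C = to (∈-⋃ p i) i∈
                   in from (∈-⋃ (p ∪ q) i) (C , from (∈-∪ p q C) (inj₁ C∈p) , i∈C))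
         , (λ i∈ → let C , C∈q , i∈C = to (∈-⋃ q i) i∈
                   in from (∈-⋃ (p ∪ q) i) (C , from (∈-∪ p q C) (inj₂ C∈q) , i∈C))
         ] ∘ to (∈-∪ (⋃ p) (⋃ q) i))

≡⋃⇒isBigUnion : ∀ {U D} → U ≡ ⋃ D → IsBigUnion U D
≡⋃⇒isBigUnion {D = D} refl = ⋃-isBigUnion D

isBigUnion-｛｝ : ∀ {U B} → IsBigUnion U ｛ B ｝ → U ≡ B
isBigUnion-｛｝ {U} {B} U=⋃｛B｝ = trans (isBigUnion⇒≡⋃ U=⋃｛B｝) (sym (isBigUnion⇒≡⋃ (｛｝-isBigUnion B)))

image : (ℕ → ℕ) → ℕ → ℕ
image f s = ⋃ᴸ (map (｛_｝ ∘ f) (elems s))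

∈-image : ∀ f s y → y ∈ₕ image f s ⇔ (∃[ x ] (x ∈ₕ s × f x ≡ y))
∈-image f s y = mk⇔
  (λ y∈ → let C , C∈ , y∈C = to (∈-⋃ᴸ y _) y∈
              x , x∈ , C≡ = ∈-map⁻ (｛_｝ ∘ f) C∈
          in x , to (∈-elems {s}) x∈ , sym (to (∈-｛｝ (f x) y) (subst (y ∈ₕ_) C≡ y∈C)))
  (λ (x , x∈s , fx≡y) →
     from (∈-⋃ᴸ y _) (｛ f x ｝ , ∈-map⁺ (｛_｝ ∘ f) (from (∈-elems {s}) x∈s) ,
                      from (∈-｛｝ (f x) y) (sym fx≡y)))

-- Splittings and partitions

record Split (V A B : ℕ) : Set where
  field
    ⊆ˡ       : A ⊆ₕ V
    ⊆ʳ       : B ⊆ₕ V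
    disjoint : Disjoint A B
    cover    : ∀ i → i ∈ₕ V → i ∈ₕ A ⊎ i ∈ₕ B

T-decompᵇ : ∀ {V A B} → T (decompᵇ V A B) ⇔ Split V A B
T-decompᵇ {V} {A} {B} = mk⇔ split unsplit
  where
  split : T (decompᵇ V A B) → Split V A B
  split h =
    let A⊆V , h₁ = to (T-∧ {subsetᵇ A V}) h
        B⊆V , h₂ = to (T-∧ {subsetᵇ B V}) h₁
        A∩B=∅ , A∪B=V = to (T-∧ {disjointᵇ A B}) h₂
    in record
      { ⊆ˡ = to T-subsetᵇ A⊆V
      ; ⊆ʳ = to T-subsetᵇ B⊆V
      ; disjoint = to T-disjointᵇ A∩B=∅
      ; cover = λ i i∈V → to (T-∨ {bit A i}) (to T-all-elems A∪B=V i i∈V)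
      }
  unsplit : Split V A B → T (decompᵇ V A B)
  unsplit V=A+B = from T-∧ (from T-subsetᵇ ⊆ˡ , from T-∧ (from T-subsetᵇ ⊆ʳ ,
    from T-∧ (from T-disjointᵇ disjoint , from T-all-elems λ i → from T-∨ ∘ cover i)))
    where open Split V=A+B

record IsPartition (V p : ℕ) : Set where
  field
    nonempty     : ∀ B → B ∈ₕ p → ∃[ i ] (i ∈ₕ B)
    ⊆ground      : ∀ B → B ∈ₕ p → B ⊆ₕ V
    unique-block : ∀ {B B'} i → B ∈ₕ p → B' ∈ₕ p → i ∈ₕ B → i ∈ₕ B' → B ≡ B'
    cover        : ∀ i → i ∈ₕ V → ∃[ B ] (B ∈ₕ p × i ∈ₕ B)

≢0⇒inhabited : ∀ {B} → B ≢ 0 → ∃[ i ] (i ∈ₕ B)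
≢0⇒inhabited {B} B≢0 with elems B in eq
... | []    = ⊥-elim (B≢0 (uninhabited⇒≡0 λ i i∈B →
                case subst (i ∈_) eq (from (∈-elems {B}) i∈B) of λ ()))
... | i ∷ _ = i , to (∈-elems {B}) (subst (i ∈_) (sym eq) (here refl))

T-≢0 : ∀ {B} → T (not (B ≡ᵇ 0)) ⇔ B ≢ 0
T-≢0 {B} = mk⇔ (λ h B≡0 → subst T (to T-not-≡ h) (≡⇒≡ᵇ B 0 B≡0))
               (λ B≢0 → from T-not-≡ (T-injective (B≢0 ∘ ≡ᵇ⇒≡ B 0) λ ()))

T-isPartᵇ : ∀ {V p} → T (isPartᵇ V p) ⇔ IsPartition V p
T-isPartᵇ {V} {p} = mk⇔ partition unpartition
  where
  partition : T (isPartᵇ V p) → IsPartition V p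
  partition h =
    let nonempty-blocks , h₁ = to T-∧ h
        pairs , covers = to T-∧ h₁
        block : ∀ B → B ∈ₕ p → B ≢ 0 × B ⊆ₕ V
        block B B∈p = let B≢0 , B⊆V = to (T-∧ {not (B ≡ᵇ 0)}) (to T-all-elems nonempty-blocks B B∈p)
                      in to T-≢0 B≢0 , to T-subsetᵇ B⊆V
    in record
      { nonempty = λ B → ≢0⇒inhabited ∘ proj₁ ∘ block B
      ; ⊆ground = λ B → proj₂ ∘ block B
      ; unique-block = λ {B} {B'} i B∈p B'∈p i∈B i∈B' →
          case to (T-∨ {B ≡ᵇ B'}) (to T-all-elems (to T-all-elems pairs B B∈p) B' B'∈p) of λ where
            (inj₁ B≡B') → ≡ᵇ⇒≡ B B' B≡B'
            (inj₂ B∩B'=∅) → ⊥-elim (to T-disjointᵇ B∩B'=∅ i i∈B i∈B')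
      ; cover = λ i → to T-any-elems ∘ to T-all-elems covers i
      }
  unpartition : IsPartition V p → T (isPartᵇ V p)
  unpartition P = from T-∧ (from T-all-elems nonempty-blocks , from T-∧ (from T-all-elems pairs ,
                                                             from T-all-elems λ i → from T-any-elems ∘ cover i))
    where
    open IsPartition P
    nonempty-blocks : ∀ B → B ∈ₕ p → T (not (B ≡ᵇ 0) ∧ subsetᵇ B V)
    nonempty-blocks B B∈p =
      from T-∧ (from (T-≢0 {B}) (λ { refl → let i , i∈0 = nonempty 0 B∈p in ∉0 i i∈0 }) ,
                from T-subsetᵇ (⊆ground B B∈p))
    pairs : ∀ B → B ∈ₕ p → T (all (λ B' → (B ≡ᵇ B') ∨ disjointᵇ B B') (elems p))
    pairs B B∈p = from T-all-elems λ B' B'∈p → case B ≟ B' of λ where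
      (yes B≡B') → from (T-∨ {B ≡ᵇ B'}) (inj₁ (≡⇒≡ᵇ B B' B≡B'))
      (no B≢B')  → from (T-∨ {B ≡ᵇ B'}) (inj₂ (from T-disjointᵇ λ i i∈B i∈B' →
                                           B≢B' (unique-block i B∈p B'∈p i∈B i∈B')))

module _ {V A B : ℕ} (V=A+B : Split V A B) where
  open Split V=A+B

  split-sym : Split V B A
  split-sym = record
    { ⊆ˡ = ⊆ʳ ; ⊆ʳ = ⊆ˡ
    ; disjoint = λ i i∈B i∈A → disjoint i i∈A i∈B
    ; cover = λ i → [ inj₂ , inj₁ ] ∘ cover i
    }

  split-complement-unique : ∀ {B'} → Split V A B' → B ≡ B'
  split-complement-unique {B'} V=A+B' = set-ext (complement V=A+B V=A+B') (complement V=A+B' V=A+B)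
    where
    complement : ∀ {C C'} → Split V A C → Split V A C' → C ⊆ₕ C'
    complement V=A+C V=A+C' i i∈C with Split.cover V=A+C' i (Split.⊆ʳ V=A+C i i∈C)
    ... | inj₁ i∈A  = ⊥-elim (Split.disjoint V=A+C i i∈A i∈C)
    ... | inj₂ i∈C' = i∈C'

  split-assocʳ : ∀ {A₁ A₂} → Split A A₁ A₂ → Split V A₁ (A₂ ∪ B) × Split (A₂ ∪ B) A₂ B
  split-assocʳ {A₁} {A₂} A=A₁+A₂ =
    record
      { ⊆ˡ = λ i → ⊆ˡ i ∘ inner.⊆ˡ i
      ; ⊆ʳ = λ i → [ ⊆ˡ i ∘ inner.⊆ʳ i , ⊆ʳ i ] ∘ to (∈-∪ A₂ B i)
      ; disjoint = λ i i∈A₁ → [ inner.disjoint i i∈A₁ , disjoint i (inner.⊆ˡ i i∈A₁) ] ∘ to (∈-∪ A₂ B i)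
      ; cover = λ i i∈V → case cover i i∈V of λ where
          (inj₁ i∈A) → [ inj₁ , inj₂ ∘ from (∈-∪ A₂ B i) ∘ inj₁ ] (inner.cover i i∈A)
          (inj₂ i∈B) → inj₂ (from (∈-∪ A₂ B i) (inj₂ i∈B))
      } ,
    record
      { ⊆ˡ = λ i → from (∈-∪ A₂ B i) ∘ inj₁
      ; ⊆ʳ = λ i → from (∈-∪ A₂ B i) ∘ inj₂
      ; disjoint = λ i i∈A₂ → disjoint i (inner.⊆ʳ i i∈A₂)
      ; cover = λ i → to (∈-∪ A₂ B i)
      }
    where module inner = Split A=A₁+A₂

∪-comm : ∀ s t → s ∪ t ≡ t ∪ s
∪-comm s t = set-ext (swap s t) (swap t s)
  where
  swap : ∀ s t → s ∪ t ⊆ₕ t ∪ s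
  swap s t i = from (∈-∪ t s i) ∘ [ inj₂ , inj₁ ] ∘ to (∈-∪ s t i)

split-assocˡ : ∀ {V A B B₁ B₂} → Split V A B → Split B B₁ B₂ →
               Split V (A ∪ B₁) B₂ × Split (A ∪ B₁) A B₁
split-assocˡ {A = A} {B₁ = B₁} V=A+B B=B₁+B₂
  with split-assocʳ (split-sym V=A+B) (split-sym B=B₁+B₂)
... | V=B₂+[B₁∪A] , B₁∪A=B₁+A rewrite ∪-comm B₁ A =
  split-sym V=B₂+[B₁∪A] , split-sym B₁∪A=B₁+A

split-∅ʳ : ∀ {V} → Split V V 0
split-∅ʳ = record { ⊆ˡ = λ _ → id ; ⊆ʳ = λ i → ⊥-elim ∘ ∉0 i
                  ; disjoint = λ i _ → ∉0 i ; cover = λ _ → inj₁ }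

split-∅ : ∀ {V B} → Split V V B → B ≡ 0
split-∅ V=V+B = split-complement-unique V=V+B split-∅ʳ

split-∅ˡ : ∀ {V B} → Split V 0 B → B ≡ V
split-∅ˡ V=0+B = split-complement-unique V=0+B (split-sym split-∅ʳ)

partition-of-∅ : ∀ {p} → IsPartition 0 p → p ≡ 0
partition-of-∅ P = uninhabited⇒≡0 λ B B∈p →
  let i , i∈B = IsPartition.nonempty P B B∈p in ∉0 i (IsPartition.⊆ground P B B∈p i i∈B)

∅-partition : IsPartition 0 0
∅-partition = record { nonempty = λ B → ⊥-elim ∘ ∉0 B ; ⊆ground = λ B → ⊥-elim ∘ ∉0 B
                     ; unique-block = λ {B} _ → ⊥-elim ∘ ∉0 B ; cover = λ i → ⊥-elim ∘ ∉0 i }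

singletons-partition : ∀ p → IsPartition p (image ｛_｝ p)
singletons-partition p = record
  { nonempty = λ D D∈ → let B , _ , ｛B｝≡D = to (∈-image ｛_｝ p D) D∈
                        in B , subst (B ∈ₕ_) ｛B｝≡D (from (∈-｛｝ B B) refl)
  ; ⊆ground = λ D D∈ i → proj₁ ∘ member D D∈ i
  ; unique-block = λ {D} {D'} i D∈ D'∈ i∈D i∈D' →
      trans (sym (proj₂ (member D D∈ i i∈D))) (proj₂ (member D' D'∈ i i∈D'))
  ; cover = λ i i∈p → ｛ i ｝ , from (∈-image ｛_｝ p ｛ i ｝) (i , i∈p , refl) , from (∈-｛｝ i i) refl
  }
  where
  member : ∀ D → D ∈ₕ image ｛_｝ p → ∀ i → i ∈ₕ D → i ∈ₕ p × ｛ i ｝ ≡ D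
  member D D∈ i i∈D =
    let B , B∈p , ｛B｝≡D = to (∈-image ｛_｝ p D) D∈
        i≡B = to (∈-｛｝ B i) (subst (i ∈ₕ_) (sym ｛B｝≡D) i∈D)
    in subst (_∈ₕ p) (sym i≡B) B∈p , trans (cong ｛_｝ i≡B) ｛B｝≡D

⋃-injective : ∀ {V pa pb D D'} → IsPartition V pa → IsPartition pa pb →
              D ∈ₕ pb → D' ∈ₕ pb → ⋃ D ≡ ⋃ D' → D ≡ D'
⋃-injective {D = D} {D'} Pa Pb D∈pb D'∈pb ⋃D≡⋃D' =
  let C , C∈D = Pb.nonempty D D∈pb
      C∈pa = Pb.⊆ground D D∈pb C C∈D
      i , i∈C = Pa.nonempty C C∈pa
      C' , C'∈D' , i∈C' = to (∈-⋃ D' i)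
                            (subst (i ∈ₕ_) ⋃D≡⋃D' (from (∈-⋃ D i) (C , C∈D , i∈C)))
      C≡C' = Pa.unique-block i C∈pa (Pb.⊆ground D' D'∈pb C' C'∈D') i∈C i∈C'
  in Pb.unique-block C D∈pb D'∈pb C∈D (subst (_∈ₕ D') (sym C≡C') C'∈D')
  where
  module Pa = IsPartition Pa
  module Pb = IsPartition Pb

partition⇒isBigUnion : ∀ {V p} → IsPartition V p → IsBigUnion V p
partition⇒isBigUnion P i = IsPartition.cover P i , λ (B , B∈p , i∈B) → IsPartition.⊆ground P B B∈p i i∈B

Refines : ℕ → ℕ → Set
Refines p q = ∀ C → C ∈ₕ p → ∃[ W ] (W ∈ₕ q × C ⊆ₕ W)

refines-antisym : ∀ {V W p q} → IsPartition V p → IsPartition W q → Refines p q → Refines q p → p ≡ q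
refines-antisym P Q p≤q q≤p = set-ext (coarser P p≤q q≤p) (coarser Q q≤p p≤q)
  where
  coarser : ∀ {V p q} → IsPartition V p → Refines p q → Refines q p → p ⊆ₕ q
  coarser P p≤q q≤p C C∈p =
    let W , W∈q , C⊆W = p≤q C C∈p
        C' , C'∈p , W⊆C' = q≤p W W∈q
        i , i∈C = IsPartition.nonempty P C C∈p
        C≡C' = IsPartition.unique-block P i C∈p C'∈p i∈C (W⊆C' i (C⊆W i i∈C))
        W⊆C = subst (W ⊆ₕ_) (sym C≡C') W⊆C'
    in subst (_∈ₕ _) (set-ext W⊆C C⊆W) W∈q

Elem-≡ : ∀ {s} {x y : Elem s} → val x ≡ val y → x ≡ y
Elem-≡ {x = i , _} refl = cong (i ,_) (T-irrelevant _ _)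

⋃-bijection : ∀ {Q E} → (∀ D → D ∈ₕ Q → ⋃ D ∈ₕ E) →
              (∀ U → U ∈ₕ E → ∃[ D ] (D ∈ₕ Q × IsBigUnion U D)) →
              (∀ {D D'} → D ∈ₕ Q → D' ∈ₕ Q → ⋃ D ≡ ⋃ D' → D ≡ D') →
              Σ (Elem Q ↔ Elem E) λ φ → ∀ D → IsBigUnion (val (Inverse.to φ D)) (val D)
⋃-bijection {Q} {E} ⋃∈E onto injective = mk↔ₛ′ ⋃′ unionOf ⋃∘unionOf unionOf∘⋃ , ⋃-isBigUnion ∘ val
  where
  ⋃′ : Elem Q → Elem E
  ⋃′ (D , D∈Q) = ⋃ D , ⋃∈E D D∈Q
  unionOf : Elem E → Elem Q
  unionOf (U , U∈E) = let D , D∈Q , _ = onto U U∈E in D , D∈Q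
  ⋃∘unionOf : ∀ U → ⋃′ (unionOf U) ≡ U
  ⋃∘unionOf (U , U∈E) = Elem-≡ (sym (isBigUnion⇒≡⋃ (proj₂ (proj₂ (onto U U∈E)))))
  unionOf∘⋃ : ∀ D → unionOf (⋃′ D) ≡ D
  unionOf∘⋃ (D , D∈Q) =
    let D' , D'∈Q , ⋃D=⋃D' = onto (⋃ D) (⋃∈E D D∈Q)
    in Elem-≡ (injective D'∈Q D∈Q (sym (isBigUnion⇒≡⋃ ⋃D=⋃D')))

⋃-preimage : ℕ → ℕ → ℕ
⋃-preimage q e = filterₕ (λ D → bit e (⋃ D)) q

∈-⋃-preimage : ∀ q e D → D ∈ₕ ⋃-preimage q e ⇔ (D ∈ₕ q × ⋃ D ∈ₕ e)
∈-⋃-preimage q e D = ∈-filterₕ (λ D → bit e (⋃ D)) q D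

-- Assemblies

module _ {X : ℕ → Set} where

  partition : ∀ {V} (a : Asm X V) → IsPartition V (part a)
  partition a = to T-isPartᵇ (isPart a)

  comp : ∀ {V} (a : Asm X V) C → C ∈ₕ part a → X C
  comp a C C∈a = lookup (comps a) (from (∈-elems {part a}) C∈a)

  lookup≡comp : ∀ {V} (a : Asm X V) {C} (x : C ∈ blocks a) →
                lookup (comps a) x ≡ comp a C (to (∈-elems {part a}) x)
  lookup≡comp a x = cong (lookup (comps a)) (∈-elems-irrelevant {part a} x _)

  comp-irrelevant : ∀ {V} (a : Asm X V) C (h h' : C ∈ₕ part a) → comp a C h ≡ comp a C h'
  comp-irrelevant a C h h' = cong (comp a C) (T-irrelevant h h')

  mkAsm : ∀ {V p} → IsPartition V p → (∀ C → C ∈ₕ p → X C) → Asm X V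
  mkAsm {p = p} P f = asm p (from T-isPartᵇ P) (tabulate λ {C} x → f C (to (∈-elems {p}) x))

  comp-mkAsm : ∀ {V p} (P : IsPartition V p) (f : ∀ C → C ∈ₕ p → X C) C h →
               comp (mkAsm P f) C h ≡ f C h
  comp-mkAsm {p = p} P f C h =
    trans (lookup-tabulate (from (∈-elems {p}) h)) (cong (f C) (T-irrelevant _ _))
    where
    lookup-tabulate : ∀ {Cs} {g : ∀ {C} → C ∈ Cs → X C} {C} (x : C ∈ Cs) → lookup (tabulate g) x ≡ g x
    lookup-tabulate {_ ∷ _} (here refl) = refl
    lookup-tabulate {_ ∷ _} (there x)   = lookup-tabulate x

  asm-ext : ∀ {V} (a b : Asm X V) → part a ≡ part b →
            (∀ C ha hb → comp a C ha ≡ comp b C hb) → a ≡ b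
  asm-ext (asm p P ωs) (asm .p P' ωs') refl same-comps with T-irrelevant P P'
  ... | refl = cong (asm p P) (All-ext ωs ωs' λ x →
      trans (lookup≡comp (asm p P ωs) x) (trans (same-comps _ _ _) (sym (lookup≡comp (asm p P ωs') x))))
    where
    All-ext : ∀ {Cs} (ωs ωs' : All X Cs) → (∀ {C} (x : C ∈ Cs) → lookup ωs x ≡ lookup ωs' x) → ωs ≡ ωs'
    All-ext []       []         _    = refl
    All-ext (ω ∷ ωs) (ω' ∷ ωs') same = cong₂ _∷_ (same (here refl)) (All-ext ωs ωs' (same ∘ there))

  subAsm⁺ : ∀ {V U} (a : Asm X V) (r : Asm X U) → part r ⊆ₕ part a →
            (∀ C hr ha → comp r C hr ≡ comp a C ha) → IsSubAsm a r
  subAsm⁺ a r r⊆a same-comps = r⊆a , λ C x y →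
    trans (lookup≡comp r x) (trans (same-comps C _ _) (sym (lookup≡comp a y)))

  subAsm-comp : ∀ {V U} (a : Asm X V) (r : Asm X U) → IsSubAsm a r →
                ∀ C hr ha → comp r C hr ≡ comp a C ha
  subAsm-comp a r (_ , same-comps) C hr ha =
    same-comps C (from (∈-elems {part r}) hr) (from (∈-elems {part a}) ha)

  subAsm-refl : ∀ {V} (a : Asm X V) → IsSubAsm a a
  subAsm-refl a = subAsm⁺ a a (λ _ → id) (comp-irrelevant a)

  subAsm-trans : ∀ {V U W} (a : Asm X V) (r : Asm X U) (t : Asm X W) →
                 IsSubAsm a r → IsSubAsm r t → IsSubAsm a t
  subAsm-trans a r t r⊑a t⊑r = subAsm⁺ a t (λ C → proj₁ r⊑a C ∘ proj₁ t⊑r C) λ C ht ha →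
    trans (subAsm-comp r t t⊑r C ht (proj₁ t⊑r C ht)) (subAsm-comp a r r⊑a C _ ha)

  subAsm-between : ∀ {V U W} (a : Asm X V) (r : Asm X U) (t : Asm X W) →
                   IsSubAsm a r → IsSubAsm a t → part t ⊆ₕ part r → IsSubAsm r t
  subAsm-between a r t r⊑a t⊑a t⊆r = subAsm⁺ r t t⊆r λ C ht hr →
    let ha = proj₁ t⊑a C ht in trans (subAsm-comp a t t⊑a C ht ha) (sym (subAsm-comp a r r⊑a C hr ha))

  restrict-partition : ∀ {V} (a : Asm X V) {q U} → q ⊆ₕ part a → IsBigUnion U q → IsPartition U q
  restrict-partition a q⊆a U=⋃q = record
    { nonempty = λ B → nonempty B ∘ q⊆a B
    ; ⊆ground = λ B B∈q i i∈B → proj₂ (U=⋃q i) (B , B∈q , i∈B)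
    ; unique-block = λ {B} {B'} i B∈q B'∈q → unique-block i (q⊆a B B∈q) (q⊆a B' B'∈q)
    ; cover = λ i → proj₁ (U=⋃q i)
    }
    where open IsPartition (partition a)

  restrict : ∀ {V} (a : Asm X V) {q} U → q ⊆ₕ part a → IsBigUnion U q → Asm X U
  restrict a U q⊆a U=⋃q = mkAsm (restrict-partition a q⊆a U=⋃q) (λ C → comp a C ∘ q⊆a C)

  subAsm-restrict : ∀ {V} (a : Asm X V) {q} U (q⊆a : q ⊆ₕ part a) (U=⋃q : IsBigUnion U q) →
                    IsSubAsm a (restrict a U q⊆a U=⋃q)
  subAsm-restrict a {q} U q⊆a U=⋃q = subAsm⁺ a (restrict a U q⊆a U=⋃q) q⊆a λ C hr ha →
    trans (comp-mkAsm (restrict-partition a q⊆a U=⋃q) (λ C → comp a C ∘ q⊆a C) C hr)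
          (comp-irrelevant a C _ ha)

-- The relation c = η̄(a, b)

module _ {X : ℕ → Set} {η : ∀ {U} (r : Asm X U) → X (part r) → X U} where

  module EtaBar {V} {a : Asm X V} {b : Asm X (part a)} {c : Asm X V} (c=ab : IsEtaBar X η a b c) where

    etaBar-block⁺ : ∀ D → D ∈ₕ part b → ⋃ D ∈ₕ part c
    etaBar-block⁺ D D∈b = proj₂ (proj₁ c=ab (⋃ D)) (D , D∈b , ⋃-isBigUnion D)

    etaBar-block⁻ : ∀ U → U ∈ₕ part c → ∃[ D ] (D ∈ₕ part b × IsBigUnion U D)
    etaBar-block⁻ U = proj₁ (proj₁ c=ab U)

    etaBar-bijection : Σ (Elem (part b) ↔ Elem (part c)) λ φ →
                         ∀ D → IsBigUnion (val (Inverse.to φ D)) (val D)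
    etaBar-bijection = ⋃-bijection etaBar-block⁺ etaBar-block⁻
                                   (⋃-injective (partition a) (partition b))

    etaBar-refines : Refines (part a) (part c)
    etaBar-refines C C∈a =
      let D , D∈b , C∈D = IsPartition.cover (partition b) C C∈a
      in ⋃ D , etaBar-block⁺ D D∈b , λ i i∈C → from (∈-⋃ D i) (C , C∈D , i∈C)

    etaBar-restrict : ∀ {V₁} (a₁ : Asm X V₁) (b₁ : Asm X (part a₁)) (c₁ : Asm X V₁) →
                      IsSubAsm a a₁ → IsSubAsm b b₁ → IsSubAsm c c₁ →
                      part b₁ ≡ ⋃-preimage (part b) (part c₁) → IsEtaBar X η a₁ b₁ c₁
    etaBar-restrict a₁ b₁ c₁ a₁⊑a b₁⊑b c₁⊑c b₁-blocks = blocks₁ , comps₁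
      where
      blocks₁ : ∀ U → (U ∈ₕ part c₁ → ∃[ D ] (D ∈ₕ part b₁ × IsBigUnion U D)) ×
                      (∃[ D ] (D ∈ₕ part b₁ × IsBigUnion U D) → U ∈ₕ part c₁)
      blocks₁ U =
        (λ U∈c₁ → let D , D∈b , U=⋃D = etaBar-block⁻ U (proj₁ c₁⊑c U U∈c₁)
                      ⋃D∈c₁ = subst (_∈ₕ part c₁) (isBigUnion⇒≡⋃ U=⋃D) U∈c₁
                  in D , subst (D ∈ₕ_) (sym b₁-blocks) (from (∈-⋃-preimage (part b) (part c₁) D) (D∈b , ⋃D∈c₁)) ,
                     U=⋃D) ,
        (λ (D , D∈b₁ , U=⋃D) →
          let _ , ⋃D∈c₁ = to (∈-⋃-preimage (part b) (part c₁) D) (subst (D ∈ₕ_) b₁-blocks D∈b₁)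
          in subst (_∈ₕ part c₁) (sym (isBigUnion⇒≡⋃ U=⋃D)) ⋃D∈c₁)
      comps₁ : ∀ D U (x : D ∈ blocks b₁) (y : U ∈ blocks c₁) → IsBigUnion U D →
               ∀ (r : Asm X U) (e : part r ≡ D) → IsSubAsm a₁ r →
               lookup (comps c₁) y ≡ η r (subst X (sym e) (lookup (comps b₁) x))
      comps₁ D U x y U=⋃D r refl r⊑a₁ =
        let D∈b = proj₁ b₁⊑b D (to (∈-elems {part b₁}) x)
            U∈c = proj₁ c₁⊑c U (to (∈-elems {part c₁}) y)
        in begin
          lookup (comps c₁) y    ≡⟨ proj₂ c₁⊑c U y (from (∈-elems {part c}) U∈c) ⟩
          lookup (comps c) _     ≡⟨ proj₂ c=ab D U (from (∈-elems {part b}) D∈b) _ U=⋃D r refl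
                                      (subAsm-trans a a₁ r a₁⊑a r⊑a₁) ⟩
          η r (lookup (comps b) _) ≡⟨ cong (η r) (sym (proj₂ b₁⊑b D x _)) ⟩
          η r (lookup (comps b₁) x) ∎
        where open ≡-Reasoning

    over : ℕ → ℕ
    over e = ⋃ (⋃-preimage (part b) e)

    ∈-over : ∀ e C → C ∈ₕ over e ⇔ (∃[ D ] (D ∈ₕ part b × ⋃ D ∈ₕ e × C ∈ₕ D))
    ∈-over e C = mk⇔
      (λ C∈ → let D , D∈ , C∈D = to (∈-⋃ (⋃-preimage (part b) e) C) C∈
                  D∈b , ⋃D∈e = to (∈-⋃-preimage (part b) e D) D∈
              in D , D∈b , ⋃D∈e , C∈D)
      (λ (D , D∈b , ⋃D∈e , C∈D) → from (∈-⋃ (⋃-preimage (part b) e) C)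
                                     (D , from (∈-⋃-preimage (part b) e D) (D∈b , ⋃D∈e) , C∈D))

    preimage⊆b : ∀ e → ⋃-preimage (part b) e ⊆ₕ part b
    preimage⊆b e D = proj₁ ∘ to (∈-⋃-preimage (part b) e D)

    over⊆a : ∀ e → over e ⊆ₕ part a
    over⊆a e C C∈ = let D , D∈b , _ , C∈D = to (∈-over e C) C∈
                    in IsPartition.⊆ground (partition b) D D∈b C C∈D

    ⋃-over : ∀ {e} → e ⊆ₕ part c → ⋃ (over e) ≡ ⋃ e
    ⋃-over {e} e⊆c = set-ext
      (λ i i∈ → let C , C∈ , i∈C = to (∈-⋃ (over e) i) i∈
                    D , _ , ⋃D∈e , C∈D = to (∈-over e C) C∈
                in from (∈-⋃ e i)
                     (⋃ D , ⋃D∈e , from (∈-⋃ D i) (C , C∈D , i∈C)))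
      (λ i i∈ → let W , W∈e , i∈W = to (∈-⋃ e i) i∈
                    D , D∈b , W=⋃D = etaBar-block⁻ W (e⊆c W W∈e)
                    C , C∈D , i∈C = proj₁ (W=⋃D i) i∈W
                    ⋃D∈e = subst (_∈ₕ e) (isBigUnion⇒≡⋃ W=⋃D) W∈e
                in from (∈-⋃ (over e) i)
                     (C , from (∈-over e C) (D , D∈b , ⋃D∈e , C∈D) , i∈C))

    etaBar-split : ∀ {e₁ e₂} → Split (part c) e₁ e₂ → Split (part a) (over e₁) (over e₂)
    etaBar-split {e₁} {e₂} c=e₁+e₂ = record
      { ⊆ˡ = over⊆a e₁
      ; ⊆ʳ = over⊆a e₂
      ; disjoint = λ C C∈₁ C∈₂ →
          let D₁ , D₁∈b , ⋃D₁∈e₁ , C∈D₁ = to (∈-over e₁ C) C∈₁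
              D₂ , D₂∈b , ⋃D₂∈e₂ , C∈D₂ = to (∈-over e₂ C) C∈₂
              D₁≡D₂ = IsPartition.unique-block (partition b) C D₁∈b D₂∈b C∈D₁ C∈D₂
          in Split.disjoint c=e₁+e₂ (⋃ D₁) ⋃D₁∈e₁ (subst (λ D → ⋃ D ∈ₕ e₂) (sym D₁≡D₂) ⋃D₂∈e₂)
      ; cover = λ C C∈a →
          let D , D∈b , C∈D = IsPartition.cover (partition b) C C∈a
              lies-over : ∀ e → ⋃ D ∈ₕ e → C ∈ₕ over e
              lies-over e ⋃D∈e = from (∈-over e C) (D , D∈b , ⋃D∈e , C∈D)
          in Sum.map (lies-over e₁) (lies-over e₂)
               (Split.cover c=e₁+e₂ (⋃ D) (etaBar-block⁺ D D∈b))
      }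

  module EtaBarOver {V} {a : Asm X V} {b : Asm X (part a)} {c : Asm X V} (c=ab : IsEtaBar X η a b c)
                    {U₁} (c₁ : Asm X U₁) (c₁⊑c : IsSubAsm c c₁) where

    open EtaBar {a = a} {b} {c} c=ab

    U₁=⋃over : IsBigUnion U₁ (over (part c₁))
    U₁=⋃over = ≡⋃⇒isBigUnion (trans (isBigUnion⇒≡⋃ (partition⇒isBigUnion (partition c₁)))
                                     (sym (⋃-over (proj₁ c₁⊑c))))

    a↾ : Asm X U₁
    a↾ = restrict a U₁ (over⊆a (part c₁)) U₁=⋃over

    b↾ : Asm X (over (part c₁))
    b↾ = restrict b (over (part c₁)) (preimage⊆b (part c₁)) (⋃-isBigUnion (⋃-preimage (part b) (part c₁)))

    a↾⊑a : IsSubAsm a a↾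
    a↾⊑a = subAsm-restrict a U₁ (over⊆a (part c₁)) U₁=⋃over

    c₁=a↾b↾ : IsEtaBar X η a↾ b↾ c₁
    c₁=a↾b↾ = etaBar-restrict a↾ b↾ c₁ a↾⊑a
      (subAsm-restrict b (over (part c₁)) (preimage⊆b (part c₁)) (⋃-isBigUnion (⋃-preimage (part b) (part c₁))))
      c₁⊑c refl

-- The order on (M · E(O))[V]

tr-inverse : ∀ (S : Species) {s t} (φ : Elem s ↔ Elem t) y → tr S φ (tr S (↔-sym φ) y) ≡ y
tr-inverse S φ y =
  trans (sym (tr-∘ S (↔-sym φ) φ ↔-refl (λ x → cong val (sym (Inverse.strictlyInverseˡ φ x))) y))
        (tr-id S ↔-refl (λ _ → refl) y)

module Monop (Cm : CMonop) where
  open CMonop Cm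

  O-singleton-unique : ∀ {D U} → D ≡ ｛ U ｝ → (ω ω' : F O D) → ω ≡ ω'
  O-singleton-unique {U = U} refl ω ω' = trans (O-single U ω) (sym (O-single U ω'))

  η-over-singleton : ∀ {U} (r : Asm (F O) U) → part r ≡ ｛ U ｝ →
                     ∀ ω (U∈r : U ∈ₕ part r) → η r ω ≡ comp r U U∈r
  η-over-singleton {U} r r=｛U｝ ω U∈r = begin
    η r ω                                  ≡⟨ cong (η r) (O-singleton-unique {U = U} r=｛U｝ ω _) ⟩
    η r (subst (F O) (sym r=｛U｝) (e U)) ≡⟨ η-unitʳ (comp r U U∈r) r r=｛U｝ (λ x →
                                                trans (lookup≡comp r x) (comp-irrelevant r U _ U∈r)) ⟩
    comp r U U∈r                           ∎
    where open ≡-Reasoning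

  ν-unit-∅ : ∀ {V U} (p : T (decompᵇ V V U)) → U ≡ 0 → ∀ m z → ν (prod V U p m z) ≡ m
  ν-unit-∅ p refl m z = trans (cong (λ z → ν (prod _ 0 p m z)) (M∅-single z)) (ν-unitʳ p m)

  ∅-asm : Asm (F O) 0
  ∅-asm = mkAsm ∅-partition (λ C → ⊥-elim ∘ ∉0 C)

  ∅-subAsm : ∀ {V} (a : Asm (F O) V) → IsSubAsm a ∅-asm
  ∅-subAsm a = (λ C → ⊥-elim ∘ ∉0 C) , λ C x → ⊥-elim (∉0 C (to (∈-elems {0}) x))

  units : ∀ p → Asm (F O) p
  units p = mkAsm (singletons-partition p) λ D D∈ →
    let B , _ , ｛B｝≡D = to (∈-image ｛_｝ p D) D∈ in subst (F O) ｛B｝≡D (e B)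

  etaBar-units : ∀ {V} (a : Asm (F O) V) → IsEtaBar (F O) η a (units (part a)) a
  etaBar-units a = units-blocks , units-comps
    where
    singleton : ∀ D U → D ∈ₕ image ｛_｝ (part a) → IsBigUnion U D → U ∈ₕ part a × D ≡ ｛ U ｝
    singleton D U D∈ U=⋃D =
      let B , B∈a , ｛B｝≡D = to (∈-image ｛_｝ (part a) D) D∈
          U≡B = isBigUnion-｛｝ {B = B} (subst (IsBigUnion U) (sym ｛B｝≡D) U=⋃D)
      in subst (_∈ₕ part a) (sym U≡B) B∈a , trans (sym ｛B｝≡D) (cong ｛_｝ (sym U≡B))
    units-blocks : ∀ U → (U ∈ₕ part a → ∃[ D ] (D ∈ₕ image ｛_｝ (part a) × IsBigUnion U D)) ×
                    (∃[ D ] (D ∈ₕ image ｛_｝ (part a) × IsBigUnion U D) → U ∈ₕ part a)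
    units-blocks U =
      (λ U∈a → ｛ U ｝ , from (∈-image ｛_｝ (part a) ｛ U ｝) (U , U∈a , refl) , ｛｝-isBigUnion U) ,
      (λ (D , D∈ , U=⋃D) → proj₁ (singleton D U D∈ U=⋃D))
    units-comps : ∀ D U (x : D ∈ blocks (units (part a))) (y : U ∈ blocks a) → IsBigUnion U D →
                  ∀ (r : Asm (F O) U) (e : part r ≡ D) → IsSubAsm a r →
                  lookup (comps a) y ≡ η r (subst (F O) (sym e) (lookup (comps (units (part a))) x))
    units-comps D U x y U=⋃D r refl r⊑a =
      let _ , r=｛U｝ = singleton D U (to (∈-elems {image ｛_｝ (part a)}) x) U=⋃D
          U∈r = subst (U ∈ₕ_) (sym r=｛U｝) (from (∈-｛｝ U U) refl)
      in trans (lookup≡comp a y)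
           (sym (trans (η-over-singleton r r=｛U｝ _ U∈r) (subAsm-comp a r r⊑a U U∈r _)))

  Leq-refl : ∀ {V} (x : MEO Cm V) → Leq Cm x x
  Leq-refl (prod V₁ V₂ d m a) =
    0 , ∅-asm , a , ∅-subAsm a , subAsm-refl a , from T-decompᵇ (split-sym (split-∅ʳ {part a})) ,
    𝔢 , units (part a) , V₁=V₁+∅ , sym (ν-unit-∅ V₁=V₁+∅ refl m _) , etaBar-units a
    where V₁=V₁+∅ = from T-decompᵇ (split-∅ʳ {V₁})

  etaBar-same-blocks : ∀ {V} {a : Asm (F O) V} {b : Asm (F O) (part a)} {c : Asm (F O) V} →
                       IsEtaBar (F O) η a b c → part c ⊆ₕ part a →
                       ∀ C hc ha → comp c C hc ≡ comp a C ha
  etaBar-same-blocks {a = a} {b} {c} c=ab c⊆a C hc ha =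
    let D , D∈b , C=⋃D = etaBar-block⁻ C hc
        D≡｛C｝ = singleton D D∈b C=⋃D
        rC = restrict a C ｛C｝⊆a (｛｝-isBigUnion C)
        rC⊑a = subAsm-restrict a C ｛C｝⊆a (｛｝-isBigUnion C)
        C∈rC = from (∈-｛｝ C C) refl
    in begin
      comp c C hc                   ≡⟨ proj₂ c=ab D C (from (∈-elems {part b}) D∈b) _ C=⋃D rC (sym D≡｛C｝) rC⊑a ⟩
      η rC _                        ≡⟨ η-over-singleton rC refl _ C∈rC ⟩
      comp rC C C∈rC                ≡⟨ subAsm-comp a rC rC⊑a C C∈rC ha ⟩
      comp a C ha                   ∎
    where
    open ≡-Reasoning
    open EtaBar {η = η} {a = a} {b} {c} c=ab
    Pa = partition a
    ｛C｝⊆a : ｛ C ｝ ⊆ₕ part a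
    ｛C｝⊆a C' C'∈ = subst (_∈ₕ part a) (sym (to (∈-｛｝ C C') C'∈)) ha
    singleton : ∀ D → D ∈ₕ part b → IsBigUnion C D → D ≡ ｛ C ｝
    singleton D D∈b C=⋃D = set-ext D⊆｛C｝ λ C' C'∈｛C｝ →
      let C'' , C''∈D = IsPartition.nonempty (partition b) D D∈b
          C''≡C = to (∈-｛｝ C C'') (D⊆｛C｝ C'' C''∈D)
      in subst (_∈ₕ D) (trans C''≡C (sym (to (∈-｛｝ C C') C'∈｛C｝))) C''∈D
      where
      D⊆｛C｝ : D ⊆ₕ ｛ C ｝
      D⊆｛C｝ C' C'∈D =
        let C'∈a = IsPartition.⊆ground (partition b) D D∈b C' C'∈D
            j , j∈C' = IsPartition.nonempty Pa C' C'∈a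
        in from (∈-｛｝ C C')
             (IsPartition.unique-block Pa j C'∈a ha j∈C' (proj₂ (C=⋃D j) (C' , C'∈D , j∈C')))

  Leq-with-same-V₁ : ∀ {V V₁ V₂ V₂'} {d : T (decompᵇ V V₁ V₂)} {d' : T (decompᵇ V V₁ V₂')}
                     {m m' : F M V₁} {a : Asm (F O) V₂} {a' : Asm (F O) V₂'} →
                   Leq Cm (prod V₁ V₂ d m a) (prod V₁ V₂' d' m' a') →
                   m' ≡ m × Refines (part a) (part a') ×
                   (part a' ⊆ₕ part a → ∀ C h' h → comp a' C h' ≡ comp a C h)
  Leq-with-same-V₁ {V₁ = V₁} {m = m} {a = a} {a'}
    (U₁ , s₁ , s₂ , s₁⊑a , s₂⊑a , a=s₁+s₂ , n , b , V₁=V₁+U₁ , m'≡ , a'=s₂b) =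
    trans m'≡ (ν-unit-∅ V₁=V₁+U₁ U₁≡0 m _) ,
    subst (λ p → Refines p (part a')) s₂≡a (EtaBar.etaBar-refines {η = η} {a = s₂} {b} {a'} a'=s₂b) ,
    λ a'⊆a C h' h → let hs = subst (C ∈ₕ_) (sym s₂≡a) h in
      trans (etaBar-same-blocks {a = s₂} {b} {a'} a'=s₂b (subst (part a' ⊆ₕ_) (sym s₂≡a) a'⊆a) C h' hs)
            (subAsm-comp a s₂ s₂⊑a C hs h)
    where
    U₁≡0 : U₁ ≡ 0
    U₁≡0 = split-∅ (to (T-decompᵇ {V₁} {V₁} {U₁}) V₁=V₁+U₁)
    s₁≡0 : part s₁ ≡ 0
    s₁≡0 = partition-of-∅ (subst (λ W → IsPartition W (part s₁)) U₁≡0 (partition s₁))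
    s₂≡a : part s₂ ≡ part a
    s₂≡a = split-∅ˡ (subst (λ p → Split (part a) p (part s₂)) s₁≡0 (to T-decompᵇ a=s₁+s₂))

  Leq-antisym : ∀ {V} (x y : MEO Cm V) → Leq Cm x y → Leq Cm y x → x ≡ y
  Leq-antisym (prod V₁ V₂ d m a) (prod V₁' V₂' d' m' a')
              x≤y@(U₁ , _ , _ , _ , _ , _ , _ , _ , V₁'=V₁+U₁ , _)
              y≤x@(U₁' , _ , _ , _ , _ , _ , _ , _ , V₁=V₁'+U₁' , _) =
    same-V₁ (set-ext (Split.⊆ˡ (to (T-decompᵇ {V₁'} {V₁} {U₁}) V₁'=V₁+U₁))
                     (Split.⊆ˡ (to (T-decompᵇ {V₁} {V₁'} {U₁'}) V₁=V₁'+U₁'))) d' m' a' x≤y y≤x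
    where
    same-V₁ : ∀ {V₁'} → V₁ ≡ V₁' → ∀ {V₂'} (d' : T (decompᵇ _ V₁' V₂')) m' a' →
              Leq Cm (prod V₁ V₂ d m a) (prod V₁' V₂' d' m' a') →
              Leq Cm (prod V₁' V₂' d' m' a') (prod V₁ V₂ d m a) →
              prod V₁ V₂ d m a ≡ prod V₁' V₂' d' m' a'
    same-V₁ refl {V₂'} d' m' a' x≤y y≤x
      with split-complement-unique (to (T-decompᵇ {_} {V₁} {V₂}) d) (to (T-decompᵇ {_} {V₁} {V₂'}) d')
    ... | refl =
      let m'≡m , a≤a' , same-comps = Leq-with-same-V₁ {d = d} {d'} {m} {m'} {a} {a'} x≤y
          _ , a'≤a , _ = Leq-with-same-V₁ {d = d'} {d} {m'} {m} {a'} {a} y≤x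
          a≡a' = refines-antisym (partition a) (partition a') a≤a' a'≤a
      in cong₂ (λ (d , m) a → prod V₁ V₂ d m a)
               (cong₂ _,_ (T-irrelevant d d') (sym m'≡m))
               (asm-ext a a' a≡a' λ C h h' →
                  sym (same-comps (subst (_⊆ₕ part a) a≡a' (λ _ → id)) C h' h))

  module Compose {V} {a : Asm (F O) V} {b : Asm (F O) (part a)} {c : Asm (F O) V}
                 {b' : Asm (F O) (part c)} {d : Asm (F O) V}
                 (c=ab : IsEtaBar (F O) η a b c) (d=cb' : IsEtaBar (F O) η c b' d) where
    open EtaBar {η = η} {a = a} {b} {c} c=ab
    module Pb = IsPartition (partition b)
    module Pb' = IsPartition (partition b')

    merged : ℕ
    merged = image over (part b')

    over-block : ∀ G → G ∈ₕ merged → ∃[ E ] (E ∈ₕ part b' × over E ≡ G)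
    over-block G = to (∈-image over (part b') G)

    ⋃-over-block : ∀ {E} → E ∈ₕ part b' → ⋃ (over E) ≡ ⋃ E
    ⋃-over-block E∈b' = ⋃-over (Pb'.⊆ground _ E∈b')

    over-nonempty : ∀ E → E ∈ₕ part b' → ∃[ C ] (C ∈ₕ over E)
    over-nonempty E E∈b' =
      let W , W∈E = Pb'.nonempty E E∈b'
          D , D∈b , W=⋃D = etaBar-block⁻ W (Pb'.⊆ground E E∈b' W W∈E)
          C , C∈D = Pb.nonempty D D∈b
      in C , from (∈-over E C) (D , D∈b , subst (_∈ₕ E) (isBigUnion⇒≡⋃ W=⋃D) W∈E , C∈D)

    over-unique : ∀ {E E'} C → E ∈ₕ part b' → E' ∈ₕ part b' → C ∈ₕ over E → C ∈ₕ over E' → E ≡ E'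
    over-unique {E} {E'} C E∈b' E'∈b' C∈E C∈E' =
      let D , D∈b , ⋃D∈E , C∈D = to (∈-over E C) C∈E
          D' , D'∈b , ⋃D'∈E' , C∈D' = to (∈-over E' C) C∈E'
          D≡D' = Pb.unique-block C D∈b D'∈b C∈D C∈D'
      in Pb'.unique-block (⋃ D) E∈b' E'∈b' ⋃D∈E (subst (λ D → ⋃ D ∈ₕ E') (sym D≡D') ⋃D'∈E')

    merged-partition : IsPartition (part a) merged
    merged-partition = record
      { nonempty = λ G G∈ → let E , E∈b' , E↦G = over-block G G∈
                            in subst (λ G → ∃[ C ] (C ∈ₕ G)) E↦G (over-nonempty E E∈b')
      ; ⊆ground = λ G G∈ → let E , _ , E↦G = over-block G G∈ in subst (_⊆ₕ part a) E↦G (over⊆a E)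
      ; unique-block = λ {G} {G'} C G∈ G'∈ C∈G C∈G' →
          let E , E∈b' , E↦G = over-block G G∈
              E' , E'∈b' , E'↦G' = over-block G' G'∈
              E≡E' = over-unique C E∈b' E'∈b' (subst (C ∈ₕ_) (sym E↦G) C∈G)
                                               (subst (C ∈ₕ_) (sym E'↦G') C∈G')
          in trans (sym E↦G) (trans (cong over E≡E') E'↦G')
      ; cover = λ C C∈a →
          let D , D∈b , C∈D = Pb.cover C C∈a
              E , E∈b' , ⋃D∈E = Pb'.cover (⋃ D) (etaBar-block⁺ D D∈b)
          in over E , from (∈-image over (part b') (over E)) (E , E∈b' , refl) ,
             from (∈-over E C) (D , D∈b , ⋃D∈E , C∈D)
      }

    fibre-bijection : ∀ E → E ∈ₕ part b' →
                      Σ (Elem (⋃-preimage (part b) E) ↔ Elem E) λ φ →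
                        ∀ D → IsBigUnion (val (Inverse.to φ D)) (val D)
    fibre-bijection E E∈b' = ⋃-bijection
      (λ D → proj₂ ∘ to (∈-⋃-preimage (part b) E D))
      (λ W W∈E → let D , D∈b , W=⋃D = etaBar-block⁻ W (Pb'.⊆ground E E∈b' W W∈E)
                 in D , from (∈-⋃-preimage (part b) E D) (D∈b , subst (_∈ₕ E) (isBigUnion⇒≡⋃ W=⋃D) W∈E) ,
                    W=⋃D)
      (λ {D} {D'} D∈ D'∈ →
        ⋃-injective (partition a) (partition b) (preimage⊆b E D D∈) (preimage⊆b E D' D'∈))

    b-over : ∀ G → G ∈ₕ merged → Asm (F O) G
    b-over G G∈ = let E , _ , E↦G = over-block G G∈ in
      restrict b G (preimage⊆b E) (≡⋃⇒isBigUnion (sym E↦G))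

    composite-comp : ∀ G → G ∈ₕ merged → F O G
    composite-comp G G∈ = let E , E∈b' , _ = over-block G G∈ in
      η (b-over G G∈) (tr O (↔-sym (proj₁ (fibre-bijection E E∈b'))) (comp b' E E∈b'))

    composite : Asm (F O) (part a)
    composite = mkAsm merged-partition composite-comp

    ⋃-over-block⇔ : ∀ {U E} → E ∈ₕ part b' → IsBigUnion U (over E) ⇔ IsBigUnion U E
    ⋃-over-block⇔ E∈b' = mk⇔
      (λ U=⋃ → ≡⋃⇒isBigUnion (trans (isBigUnion⇒≡⋃ U=⋃) (⋃-over-block E∈b')))
      (λ U=⋃ → ≡⋃⇒isBigUnion (trans (isBigUnion⇒≡⋃ U=⋃) (sym (⋃-over-block E∈b'))))

    composite-blocks : ∀ U → (U ∈ₕ part d → ∃[ G ] (G ∈ₕ merged × IsBigUnion U G)) ×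
                             (∃[ G ] (G ∈ₕ merged × IsBigUnion U G) → U ∈ₕ part d)
    composite-blocks U =
      (λ U∈d → let E , E∈b' , U=⋃E = proj₁ (proj₁ d=cb' U) U∈d
               in over E , from (∈-image over (part b') (over E)) (E , E∈b' , refl) ,
                  from (⋃-over-block⇔ E∈b') U=⋃E) ,
      (λ (G , G∈ , U=⋃G) →
        let E , E∈b' , E↦G = over-block G G∈
        in proj₂ (proj₁ d=cb' U)
                 (E , E∈b' , to (⋃-over-block⇔ E∈b') (subst (IsBigUnion U) (sym E↦G) U=⋃G)))

    composite-comps : ∀ G U (x : G ∈ blocks composite) (y : U ∈ blocks d) → IsBigUnion U G →
                      ∀ (r : Asm (F O) U) (e : part r ≡ G) → IsSubAsm a r →
                      lookup (comps d) y ≡ η r (subst (F O) (sym e) (lookup (comps composite) x))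
    composite-comps G U x y U=⋃G r refl r⊑a =
      let G∈ = to (∈-elems {merged}) x
          E , E∈b' , E↦G = over-block G G∈
          φ , φ-⋃ = fibre-bijection E E∈b'
          U=⋃E = to (⋃-over-block⇔ E∈b') (subst (IsBigUnion U) (sym E↦G) U=⋃G)
          E⊆c = Pb'.⊆ground E E∈b'
          rt = restrict c U E⊆c U=⋃E
          b↾ = b-over G G∈
          ω = tr O (↔-sym φ) (comp b' E E∈b')
          rt=rb↾ = etaBar-restrict r b↾ rt r⊑a
                     (subAsm-restrict b G (preimage⊆b E) (≡⋃⇒isBigUnion (sym E↦G)))
                     (subAsm-restrict c U E⊆c U=⋃E) refl
      in begin
        lookup (comps d) y          ≡⟨ proj₂ d=cb' E U (from (∈-elems {part b'}) E∈b') y U=⋃E rt refl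
                                         (subAsm-restrict c U E⊆c U=⋃E) ⟩
        η rt (comp b' E E∈b')       ≡⟨ cong (η rt) (sym (tr-inverse O φ _)) ⟩
        η rt (tr O φ ω)             ≡⟨ η-assoc r b↾ rt rt=rb↾ φ φ-⋃ ω ⟩
        η r (η b↾ ω)                ≡⟨ cong (η r) (sym (comp-mkAsm merged-partition composite-comp G G∈)) ⟩
        η r (comp composite G G∈)   ≡⟨ cong (η r) (sym (lookup≡comp composite x)) ⟩
        η r (lookup (comps composite) x) ∎
      where open ≡-Reasoning

    d=a·composite : IsEtaBar (F O) η a composite d
    d=a·composite = composite-blocks , composite-comps

  τ-etaBar : ∀ {V} {a : Asm (F O) V} {b : Asm (F O) (part a)} {c : Asm (F O) V}
             (c=ab : IsEtaBar (F O) η a b c) →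
             let φ = proj₁ (EtaBar.etaBar-bijection {η = η} {a = a} {b} {c} c=ab) in
             ∀ m → τ c m ≡ τ a (τ b (tr M (↔-sym φ) m))
  τ-etaBar {a = a} {b} {c} c=ab m =
    let φ , φ-⋃ = EtaBar.etaBar-bijection {η = η} {a = a} {b} {c} c=ab
    in trans (cong (τ c) (sym (tr-inverse M φ m))) (τ-assoc a b c c=ab φ φ-⋃ (tr M (↔-sym φ) m))

  ν-assoc-compat : ∀ {V₁z V₁y V₁x U₁ U₂} (p : T (decompᵇ V₁z V₁y U₂)) (q : T (decompᵇ V₁y V₁x U₁))
                   {a₁ : Asm (F O) U₁} {a₂ : Asm (F O) U₂} (a : Asm (F O) (U₁ ∪ U₂))
                   (a=a₁+a₂ : T (decompᵇ (part a) (part a₁) (part a₂))) →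
                   IsSubAsm a a₁ → IsSubAsm a a₂ → ∀ m m₁ m₂ →
                   let V₁z=V₁x+U , U=U₁+U₂ = split-assocʳ (to (T-decompᵇ {V₁z} {V₁y} {U₂}) p)
                                                          (to (T-decompᵇ {V₁y} {V₁x} {U₁}) q) in
                   ν (prod V₁y U₂ p (ν (prod V₁x U₁ q m (τ a₁ m₁))) (τ a₂ m₂))
                     ≡ ν (prod V₁x (U₁ ∪ U₂) (from T-decompᵇ V₁z=V₁x+U) m
                              (τ a (ν (prod (part a₁) (part a₂) a=a₁+a₂ m₁ m₂))))
  ν-assoc-compat {V₁z} {V₁y} {V₁x} {U₁} {U₂} p q {a₁} {a₂} a a=a₁+a₂ a₁⊑a a₂⊑a m m₁ m₂ =
    let V₁z=V₁x+U , U=U₁+U₂ = split-assocʳ (to (T-decompᵇ {V₁z} {V₁y} {U₂}) p)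
                                           (to (T-decompᵇ {V₁y} {V₁x} {U₁}) q)
    in trans (ν-assoc p q (from T-decompᵇ V₁z=V₁x+U) (from T-decompᵇ U=U₁+U₂) m (τ a₁ m₁) (τ a₂ m₂))
             (cong (λ n → ν (prod V₁x (U₁ ∪ U₂) (from T-decompᵇ V₁z=V₁x+U) m n))
                   (compat (from T-decompᵇ U=U₁+U₂) a₁ a₂ a a=a₁+a₂ a₁⊑a a₂⊑a m₁ m₂))

  Leq-trans : ∀ {V} {x y z : MEO Cm V} → Leq Cm x y → Leq Cm y z → Leq Cm x z
  Leq-trans {x = prod V₁x V₂x dx mx ax} {prod V₁y V₂y dy my ay} {prod V₁z V₂z dz mz az}
    (U₁ , s₁ , s₂ , s₁⊑ax , s₂⊑ax , ax=s₁+s₂ , m' , a' , V₁y=V₁x+U₁ , my≡ , ay=s₂a')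
    (U₂ , t₁ , t₂ , t₁⊑ay , t₂⊑ay , ay=t₁+t₂ , n' , b' , V₁z=V₁y+U₂ , mz≡ , az=t₂b') =
    U₁ ∪ U₂ , S₁ , Over₂.a↾ , S₁⊑ax , subAsm-trans ax s₂ Over₂.a↾ s₂⊑ax Over₂.a↾⊑a ,
    from T-decompᵇ ax=S₁+A₂ , k , composite , from T-decompᵇ V₁z=V₁x+U , mz≡ν , d=a·composite
    where
    open EtaBar {η = η} {a = s₂} {a'} {ay} ay=s₂a' using (over; etaBar-split)
    module Over₁ = EtaBarOver {η = η} {a = s₂} {a'} {ay} ay=s₂a' t₁ t₁⊑ay
    module Over₂ = EtaBarOver {η = η} {a = s₂} {a'} {ay} ay=s₂a' t₂ t₂⊑ay
    open Compose {a = Over₂.a↾} {Over₂.b↾} {t₂} {b'} {az} Over₂.c₁=a↾b↾ az=t₂b'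
      using (composite; d=a·composite)

    A₁ = over (part t₁)
    A₂ = over (part t₂)

    ax-split : Split (part ax) (part s₁ ∪ A₁) A₂ × Split (part s₁ ∪ A₁) (part s₁) A₁
    ax-split = split-assocˡ (to (T-decompᵇ {part ax} {part s₁} {part s₂}) ax=s₁+s₂)
                            (etaBar-split (to (T-decompᵇ {part ay} {part t₁} {part t₂}) ay=t₁+t₂))
    ax=S₁+A₂ = proj₁ ax-split
    S₁=s₁+A₁ = proj₂ ax-split

    V₁z=V₁x+U = proj₁ (split-assocʳ (to (T-decompᵇ {V₁z} {V₁y} {U₂}) V₁z=V₁y+U₂)
                                    (to (T-decompᵇ {V₁y} {V₁x} {U₁}) V₁y=V₁x+U₁))

    U=⋃S₁ : IsBigUnion (U₁ ∪ U₂) (part s₁ ∪ A₁)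
    U=⋃S₁ = ≡⋃⇒isBigUnion (trans
      (cong₂ _∪_ (isBigUnion⇒≡⋃ (partition⇒isBigUnion (partition s₁))) (isBigUnion⇒≡⋃ Over₁.U₁=⋃over))
      (sym (⋃-∪ (part s₁) A₁)))

    S₁ : Asm (F O) (U₁ ∪ U₂)
    S₁ = restrict ax (U₁ ∪ U₂) (Split.⊆ˡ ax=S₁+A₂) U=⋃S₁

    S₁⊑ax : IsSubAsm ax S₁
    S₁⊑ax = subAsm-restrict ax (U₁ ∪ U₂) (Split.⊆ˡ ax=S₁+A₂) U=⋃S₁

    φ₁ : Elem (part Over₁.b↾) ↔ Elem (part t₁)
    φ₁ = proj₁ (EtaBar.etaBar-bijection {η = η} {a = Over₁.a↾} {Over₁.b↾} {t₁} Over₁.c₁=a↾b↾)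

    n : F M A₁
    n = τ Over₁.b↾ (tr M (↔-sym φ₁) n')

    k : F M (part s₁ ∪ A₁)
    k = ν (prod (part s₁) A₁ (from T-decompᵇ S₁=s₁+A₁) m' n)

    mz≡ν : mz ≡ ν (prod V₁x (U₁ ∪ U₂) (from T-decompᵇ V₁z=V₁x+U) mx (τ S₁ k))
    mz≡ν = begin
      mz
        ≡⟨ mz≡ ⟩
      ν (prod V₁y U₂ V₁z=V₁y+U₂ my (τ t₁ n'))
        ≡⟨ cong₂ (λ m n → ν (prod V₁y U₂ V₁z=V₁y+U₂ m n))
                 my≡ (τ-etaBar {a = Over₁.a↾} {Over₁.b↾} {t₁} Over₁.c₁=a↾b↾ n') ⟩
      ν (prod V₁y U₂ V₁z=V₁y+U₂ (ν (prod V₁x U₁ V₁y=V₁x+U₁ mx (τ s₁ m'))) (τ Over₁.a↾ n))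
        ≡⟨ ν-assoc-compat V₁z=V₁y+U₂ V₁y=V₁x+U₁ {s₁} {Over₁.a↾} S₁ (from T-decompᵇ S₁=s₁+A₁)
             (subAsm-between ax S₁ s₁ S₁⊑ax s₁⊑ax (Split.⊆ˡ S₁=s₁+A₁))
             (subAsm-between ax S₁ Over₁.a↾ S₁⊑ax (subAsm-trans ax s₂ Over₁.a↾ s₂⊑ax Over₁.a↾⊑a)
                             (Split.⊆ʳ S₁=s₁+A₁))
             mx m' n ⟩
      ν (prod V₁x (U₁ ∪ U₂) (from T-decompᵇ V₁z=V₁x+U) mx (τ S₁ k)) ∎
      where open ≡-Reasoning

proposition7p1 : (C : CMonop) (V : ℕ) →
    IsPartialOrder (_≡_ {A = MEO C V}) (Leq C {V})
proposition7p1 C V = record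
  { isPreorder = record
    { isEquivalence = isEquivalence
    ; reflexive = λ { {x} refl → Leq-refl x }
    ; trans = λ {x} {y} {z} → Leq-trans {x = x} {y} {z}
    }
  ; antisym = λ {x} {y} → Leq-antisym x y
  }
  where open Monop C
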